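{- Let $e=(u_1,u_2)$ be a right edge in $T$ whose minimal mincut is $u_e^\downarrow\setminus l_e^\downarrow$, let $\textsc{lca}_e=\mathrm{LCA}(u_1,u_2)$ and $x_e=\mathrm{LCA}(l_e,\textsc{lca}_e)$. Let $Y_e=[u_1,u_2]\cup[x_e,\textsc{lca}_e]$. Then $\mathrm{top}(L_{x_e}\setminus Y_e)=\{l_e\}$.
   Context: $G=(V,E,w)$ is an undirected graph with nonnegative weights, root $r$, and $T$ a spanning tree rooted at $r$; LCA is taken in $T$. For a vertex $v$, $v^\downarrow$ ($v^\Downarrow$) is the set of descendants (strict descendants) of $v$ in $T$, and $v^\uparrow$ ($v^\Uparrow$) the set of ancestors (strict ancestors), where $v$ is its own ancestor and descendant. Cuts are identified with the side not containing $r$; size is the number of vertices; a mincut is a cut of minimum weight. The minimal mincut of an edge is the least-size mincut containing both endpoints. A comparable $2$-respecting mincut is a mincut $w^\downarrow\setminus v^\downarrow$ with $v\in w^\Downarrow$ (lower vertex $v$, upper vertex $w$). An edge is a right edge in $T$ if its minimal mincut exists and is a comparable $2$-respecting mincut. For each vertex $v$, $H(v)$ is the highest (closest to $r$) vertex $w\in v^\Uparrow$ such that $w^\downarrow\setminus v^\downarrow$ is a mincut, or $\mathsf{null}$ if there is none. For a vertex $u$, $L_u=\{v\in u^\Downarrow : H(v)\neq\mathsf{null},\ H(v)\in u^\uparrow\}$. For $S\subseteq V$, $\mathrm{top}(S)$ is the set of $v\in S$ such that no vertex of $S$ lies in $v^\Uparrow$. $[a,b]$ denotes the set of vertices on the tree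 path between $a$ and $b$.
   Formalization: The edge weights of G are nonnegative rationals. -}

module Defs where

open import Data.Nat using (ℕ; zero; suc)
open import Data.Fin using (Fin)
open import Data.Fin.Subset using (Subset; _∈_; _∉_; ∣_∣; Nonempty)
open import Data.Bool using (Bool; true; false; if_then_else_; _xor_)
open import Data.List using (List; []; _∷_)
open import Data.List.Relation.Unary.All using (All)
open import Data.List.Membership.Propositional using () renaming (_∈_ to _∈ₗ_)
open import Data.Vec using (lookup)
open import Data.Product using (Σ; ∃; _×_; _,_; proj₁; proj₂)
open import Data.Sum using (_⊎_)
open import Data.Rational using (ℚ; 0ℚ; _+_; _≤_)
open import Relation.Binary.PropositionalEquality using (_≡_; _≢_)
open import Relation.Nullary using (¬_)

Edge : ℕ → Set
Edge n = Fin n × Fin n × ℚ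

cutWeight : {n : ℕ} → List (Edge n) → Subset n → ℚ
cutWeight [] S = 0ℚ
cutWeight ((a , b , w) ∷ es) S =
  (if lookup S a xor lookup S b then w else 0ℚ) + cutWeight es S

up : {n : ℕ} → (Fin n → Fin n) → ℕ → Fin n → Fin n
up p zero v = v
up p (suc k) v = p (up p k v)

-- The setting: undirected graph G = (Fin n, edges, w) with nonnegative
-- rational weights, a root r, and a spanning tree T of G rooted at r given
-- by a parent function.
record Setting : Set where
  field
    n      : ℕ
    edges  : List (Edge n)
    nonneg : All (λ e → 0ℚ ≤ proj₂ (proj₂ e)) edges
    r      : Fin n
    parent : Fin n → Fin n
    parent-root : parent r ≡ r
    reaches-root : ∀ v → ∃ λ k → up parent k v ≡ r
    tree-edge-in-G : ∀ v → v ≢ r →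
      ∃ λ w → ((v , parent v , w) ∈ₗ edges) ⊎ ((parent v , v , w) ∈ₗ edges)

  IsEdge : Fin n → Fin n → Set
  IsEdge a b = ∃ λ w → ((a , b , w) ∈ₗ edges) ⊎ ((b , a , w) ∈ₗ edges)

  _∈↑_ : Fin n → Fin n → Set
  a ∈↑ v = ∃ λ k → up parent k v ≡ a
  _∈⇑_ : Fin n → Fin n → Set
  a ∈⇑ v = a ∈↑ v × a ≢ v
  _∈↓_ : Fin n → Fin n → Set
  a ∈↓ v = v ∈↑ a
  _∈⇓_ : Fin n → Fin n → Set
  a ∈⇓ v = v ∈⇑ a

  IsLCA : Fin n → Fin n → Fin n → Set
  IsLCA a b c = c ∈↑ a × c ∈↑ b × (∀ d → d ∈↑ a → d ∈↑ b → d ∈↑ c)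

  OnPath : Fin n → Fin n → Fin n → Set
  OnPath a b v = (v ∈↑ a ⊎ v ∈↑ b) × (∀ d → d ∈↑ a → d ∈↑ b → d ∈↑ v)

  -- cuts: the side not containing r, nonempty
  IsCut : Subset n → Set
  IsCut S = r ∉ S × Nonempty S

  IsMincut : Subset n → Set
  IsMincut S = IsCut S × (∀ S′ → IsCut S′ → cutWeight edges S ≤ cutWeight edges S′)

  _≐_ : Subset n → (Fin n → Set) → Set
  S ≐ P = ∀ x → (x ∈ S → P x) × (P x → x ∈ S)

  IsMinimalMincut : Fin n → Fin n → Subset n → Set
  IsMinimalMincut u₁ u₂ S =
    IsMincut S × u₁ ∈ S × u₂ ∈ S ×
    (∀ S′ → IsMincut S′ → u₁ ∈ S′ → u₂ ∈ S′ → ∣ S ∣ Data.Nat.≤ ∣ S′ ∣)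

  DiffIsMincut : Fin n → Fin n → Set
  DiffIsMincut w v = ∃ λ S → IsMincut S × (S ≐ (λ x → x ∈↓ w × ¬ (x ∈↓ v)))

  IsComparable2RespMincut : Subset n → Set
  IsComparable2RespMincut S =
    ∃ λ w → ∃ λ v → v ∈⇓ w × IsMincut S × (S ≐ (λ x → x ∈↓ w × ¬ (x ∈↓ v)))

  IsRightEdge : Fin n → Fin n → Set
  IsRightEdge u₁ u₂ =
    ∃ λ S → IsMinimalMincut u₁ u₂ S × IsComparable2RespMincut S

  -- H(v) = h : h is the highest strict ancestor of v with h↓ ∖ v↓ a mincut
  -- (H(v) = null iff no such h exists, i.e. HIs v h holds for no h)
  HIs : Fin n → Fin n → Set
  HIs v h = h ∈⇑ v × DiffIsMincut h v ×
            (∀ h′ → h′ ∈⇑ v → DiffIsMincut h′ v → h ∈↑ h′)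

  InL : Fin n → Fin n → Set
  InL u v = v ∈⇓ u × (∃ λ h → HIs v h × h ∈↑ u)

  InTop : (Fin n → Set) → Fin n → Set
  InTop P v = P v × (∀ y → y ∈⇑ v → ¬ P y)

module Submission where

-- Every vertex y of L_{xₑ} ∖ Yₑ lies below lₑ. Otherwise y ∈ S = uₑ↓ ∖ lₑ↓, as y lies below xₑ
-- and hence below uₑ; but the mincut A = H(y)↓ ∖ y↓ contains u₁ and u₂, because H(y) lies above
-- xₑ and so above lcaₑ, while y, being off Yₑ, is not an ancestor of u₁ or u₂. By submodularity
-- of the cut function S ∩ A is again a mincut, so the minimal mincut S of the edge lies inside A,
-- contradicting y ∉ A. Conversely lₑ ∈ L_{xₑ} ∖ Yₑ: as uₑ↓ ∖ lₑ↓ is a mincut, H(lₑ) exists and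
-- lies above uₑ, hence above xₑ. A set containing lₑ and contained in lₑ↓ has top element lₑ only.

open import Defs
open import Data.Fin using (Fin)
open import Data.Fin.Subset using (Subset)
open import Data.Product using (_×_)
open import Data.Sum using (_⊎_)
open import Relation.Binary.PropositionalEquality using (_≡_)
open import Relation.Nullary using (¬_)

open import Algebra using (CommutativeMonoid)
open import Data.Bool using (Bool; true; false; _∧_; _∨_; _xor_; if_then_else_; f≤t; b≤b)
import Data.Bool as Bool
open import Data.Empty using (⊥-elim)
open import Data.Fin.Properties using (_≟_)
open import Data.Fin.Subset using (_∈_; _∉_; _∩_; _∪_; _⊆_; Nonempty)
open import Data.Fin.Subset.Properties
  using (_∈?_; nonempty?; ⊆-antisym; p∩q⊆p; p⊂q⇒∣p∣<∣q∣; x∈p∩q⁺; x∈p∩q⁻; x∈p∪q⁺; x∈p∪q⁻)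
open import Data.List using (List; []; _∷_)
open import Data.List.Relation.Unary.All using (All; []; _∷_)
open import Data.Nat using (ℕ; zero; suc; _+_; _*_; _∸_; _<_; _≤?_; s≤s; s≤s⁻¹)
  renaming (_≤_ to _≤ℕ_)
open import Data.Nat.Properties using (≤-refl; m∸n+n≡m; m≤m*n; ≰⇒>; ≰⇒≥; ≤∧≢⇒<; <⇒≱; n≮0; anyUpTo?)
open import Data.Product using (∃; _,_; proj₁; proj₂)
open import Data.Rational using (ℚ; 0ℚ; -_) renaming (_+_ to _+ℚ_; _≤_ to _≤ℚ_)
import Data.Rational.Properties as ℚ
open import Data.Sum using (inj₁; inj₂; [_,_]; [_,_]′)
open import Data.Vec using (lookup; tabulate)
open import Data.Vec.Properties using (lookup-zipWith; lookup∘tabulate; []=⇒lookup; lookup⇒[]=)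
open import Function using (_∘_)
open import Relation.Binary.PropositionalEquality using (_≢_; refl; sym; trans; cong; subst)
open import Relation.Nullary using (Dec; yes; no; does)
open import Relation.Nullary.Decidable using (map′; decidable-stable; dec-true; _×-dec_; ¬?)
open import Relation.Unary using (Decidable)

open import Algebra.Properties.CommutativeSemigroup
  (CommutativeMonoid.commutativeSemigroup ℚ.+-0-commutativeMonoid) using (interchange)

weightIf : Bool → ℚ → ℚ
weightIf b w = if b then w else 0ℚ

weightIf-mono : ∀ {a b w} → 0ℚ ≤ℚ w → a Bool.≤ b → weightIf a w ≤ℚ weightIf b w
weightIf-mono 0≤w f≤t = 0≤w
weightIf-mono 0≤w b≤b = ℚ.≤-refl

∩∪-crossings-dominated : ∀ sa sb ta tb →
  let I = (sa ∧ ta) xor (sb ∧ tb) ; U = (sa ∨ ta) xor (sb ∨ tb) in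
  (I Bool.≤ sa xor sb × U Bool.≤ ta xor tb) ⊎ (I Bool.≤ ta xor tb × U Bool.≤ sa xor sb)
∩∪-crossings-dominated false false false false = inj₁ (b≤b , b≤b)
∩∪-crossings-dominated false false false true  = inj₁ (b≤b , b≤b)
∩∪-crossings-dominated false false true  false = inj₁ (b≤b , b≤b)
∩∪-crossings-dominated false false true  true  = inj₁ (b≤b , b≤b)
∩∪-crossings-dominated false true  false false = inj₂ (b≤b , b≤b)
∩∪-crossings-dominated false true  false true  = inj₁ (b≤b , b≤b)
∩∪-crossings-dominated false true  true  false = inj₁ (f≤t , f≤t)
∩∪-crossings-dominated false true  true  true  = inj₁ (b≤b , b≤b)
∩∪-crossings-dominated true  false false false = inj₂ (b≤b , b≤b)
∩∪-crossings-dominated true  false false true  = inj₁ (f≤t , f≤t)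
∩∪-crossings-dominated true  false true  false = inj₁ (b≤b , b≤b)
∩∪-crossings-dominated true  false true  true  = inj₁ (b≤b , b≤b)
∩∪-crossings-dominated true  true  false false = inj₁ (b≤b , b≤b)
∩∪-crossings-dominated true  true  false true  = inj₂ (b≤b , b≤b)
∩∪-crossings-dominated true  true  true  false = inj₂ (b≤b , b≤b)
∩∪-crossings-dominated true  true  true  true  = inj₁ (b≤b , b≤b)

edge-submodular : ∀ sa sb ta tb {w} → 0ℚ ≤ℚ w →
  weightIf ((sa ∧ ta) xor (sb ∧ tb)) w +ℚ weightIf ((sa ∨ ta) xor (sb ∨ tb)) w
    ≤ℚ weightIf (sa xor sb) w +ℚ weightIf (ta xor tb) w
edge-submodular sa sb ta tb {w} 0≤w with ∩∪-crossings-dominated sa sb ta tb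
... | inj₁ (I≤S , U≤A) = ℚ.+-mono-≤ (weightIf-mono 0≤w I≤S) (weightIf-mono 0≤w U≤A)
... | inj₂ (I≤A , U≤S) = ℚ.≤-trans (ℚ.+-mono-≤ (weightIf-mono 0≤w I≤A) (weightIf-mono 0≤w U≤S))
                                   (ℚ.≤-reflexive (ℚ.+-comm (weightIf (ta xor tb) w) _))

cutWeight-submodular : ∀ {n} (es : List (Edge n)) → All (λ e → 0ℚ ≤ℚ proj₂ (proj₂ e)) es →
  (S A : Subset n) → cutWeight es (S ∩ A) +ℚ cutWeight es (S ∪ A) ≤ℚ cutWeight es S +ℚ cutWeight es A
cutWeight-submodular [] [] S A = ℚ.≤-refl
cutWeight-submodular ((a , b , w) ∷ es) (0≤w ∷ 0≤es) S A
  rewrite lookup-zipWith _∧_ a S A | lookup-zipWith _∧_ b S A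
        | lookup-zipWith _∨_ a S A | lookup-zipWith _∨_ b S A = begin
    (weightIf I w +ℚ cutWeight es (S ∩ A)) +ℚ (weightIf U w +ℚ cutWeight es (S ∪ A))
      ≡⟨ interchange (weightIf I w) (cutWeight es (S ∩ A)) (weightIf U w) (cutWeight es (S ∪ A)) ⟩
    (weightIf I w +ℚ weightIf U w) +ℚ (cutWeight es (S ∩ A) +ℚ cutWeight es (S ∪ A))
      ≤⟨ ℚ.+-mono-≤ (edge-submodular sa sb ta tb 0≤w) (cutWeight-submodular es 0≤es S A) ⟩
    (weightIf (sa xor sb) w +ℚ weightIf (ta xor tb) w) +ℚ (cutWeight es S +ℚ cutWeight es A)
      ≡⟨ interchange (weightIf (sa xor sb) w) (weightIf (ta xor tb) w) (cutWeight es S) (cutWeight es A) ⟩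
    (weightIf (sa xor sb) w +ℚ cutWeight es S) +ℚ (weightIf (ta xor tb) w +ℚ cutWeight es A) ∎
  where
  open ℚ.≤-Reasoning
  sa = lookup S a
  sb = lookup S b
  ta = lookup A a
  tb = lookup A b
  I = (sa ∧ ta) xor (sb ∧ tb)
  U = (sa ∨ ta) xor (sb ∨ tb)

+-cancelʳ-≤ : ∀ r {p q} → p +ℚ r ≤ℚ q +ℚ r → p ≤ℚ q
+-cancelʳ-≤ r {p} {q} p+r≤q+r = begin
  p               ≡⟨ sym (+-r-r p) ⟩
  p +ℚ r +ℚ - r   ≤⟨ ℚ.+-monoˡ-≤ (- r) p+r≤q+r ⟩
  q +ℚ r +ℚ - r   ≡⟨ +-r-r q ⟩
  q               ∎
  where
  open ℚ.≤-Reasoning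
  +-r-r : ∀ x → x +ℚ r +ℚ - r ≡ x
  +-r-r x = trans (ℚ.+-assoc x r (- r)) (trans (cong (x +ℚ_) (ℚ.+-inverseʳ r)) (ℚ.+-identityʳ x))

greatest-satisfying : {Q : ℕ → Set} → Decidable Q → ∀ {B} → (∀ j → Q j → j < B) →
  ∀ {k₀} → Q k₀ → ∃ λ k → Q k × (∀ j → Q j → j ≤ℕ k)
greatest-satisfying Q? {zero} bounded Qk₀ = ⊥-elim (n≮0 (bounded _ Qk₀))
greatest-satisfying {Q} Q? {suc B} bounded Qk₀ with Q? B
... | yes QB = B , QB , λ j Qj → s≤s⁻¹ (bounded j Qj)
... | no ¬QB = greatest-satisfying Q? {B} bounded′ Qk₀
  where
  bounded′ : ∀ j → Q j → j < B
  bounded′ j Qj = ≤∧≢⇒< (s≤s⁻¹ (bounded j Qj)) λ { refl → ¬QB Qj }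

module _ {n : ℕ} (p : Fin n → Fin n) where

  up-+ : ∀ i j v → up p (i + j) v ≡ up p i (up p j v)
  up-+ zero    j v = refl
  up-+ (suc i) j v = cong p (up-+ i j v)

  up-∸ : ∀ {i j} v → i ≤ℕ j → up p j v ≡ up p (j ∸ i) (up p i v)
  up-∸ {i} {j} v i≤j = trans (cong (λ k → up p k v) (sym (m∸n+n≡m i≤j))) (up-+ (j ∸ i) i v)

  up-fixed : ∀ {r} → p r ≡ r → ∀ k → up p k r ≡ r
  up-fixed pr≡r zero    = refl
  up-fixed pr≡r (suc k) = trans (cong p (up-fixed pr≡r k)) pr≡r

  up-periodic : ∀ {m v} → up p m v ≡ v → ∀ t → up p (t * m) v ≡ v
  up-periodic         period zero    = refl
  up-periodic {m} {v} period (suc t) =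
    trans (up-+ m (t * m) v) (trans (cong (up p m) (up-periodic period t)) period)

module _ (𝒮 : Setting) where
  open Setting 𝒮

  up-past-root : ∀ {K k v} → up parent K v ≡ r → K ≤ℕ k → up parent k v ≡ r
  up-past-root {K} {k} {v} upKv≡r K≤k =
    trans (up-∸ parent v K≤k) (trans (cong (up parent (k ∸ K)) upKv≡r) (up-fixed parent parent-root (k ∸ K)))

  -- A cycle of the parent map returns to v after K * (m + 1) ≥ K steps, by which time it is at r.
  up-cycle⇒root : ∀ {m v} → up parent (suc m) v ≡ v → v ≡ r
  up-cycle⇒root {m} {v} cycle with reaches-root v
  ... | K , upKv≡r = trans (sym (up-periodic parent cycle K)) (up-past-root upKv≡r (m≤m*n K (suc m)))

  ∈↑-refl : ∀ {a} → a ∈↑ a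
  ∈↑-refl = 0 , refl

  ∈↑-trans : ∀ {a b c} → a ∈↑ b → b ∈↑ c → a ∈↑ c
  ∈↑-trans {c = c} (i , upib≡a) (j , upjc≡b) =
    i + j , trans (up-+ parent i j c) (trans (cong (up parent i) upjc≡b) upib≡a)

  ∈↑-total : ∀ {a b v} → a ∈↑ v → b ∈↑ v → a ∈↑ b ⊎ b ∈↑ a
  ∈↑-total {v = v} (i , upiv≡a) (j , upjv≡b) with i ≤? j
  ... | yes i≤j = inj₂ (j ∸ i , trans (cong (up parent (j ∸ i)) (sym upiv≡a))
                                      (trans (sym (up-∸ parent v i≤j)) upjv≡b))
  ... | no  i≰j = inj₁ (i ∸ j , trans (cong (up parent (i ∸ j)) (sym upjv≡b))
                                      (trans (sym (up-∸ parent v (≰⇒≥ i≰j))) upiv≡a))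

  ∈↑-root : ∀ {a} → a ∈↑ r → a ≡ r
  ∈↑-root (k , upkr≡a) = trans (sym upkr≡a) (up-fixed parent parent-root k)

  ∈↑-antisym : ∀ {a b} → a ∈↑ b → b ∈↑ a → a ≡ b
  ∈↑-antisym (zero  , b≡a) _ = sym b≡a
  ∈↑-antisym {a} {b} (suc i , upb≡a) (j , upa≡b) =
    trans a≡r (sym (∈↑-root (subst (b ∈↑_) a≡r (j , upa≡b))))
    where
    a≡r : a ≡ r
    a≡r = up-cycle⇒root {i + j}
            (trans (up-+ parent (suc i) j a) (trans (cong (up parent (suc i)) upa≡b) upb≡a))

  -- Every ancestor of v is reached within K steps, where up parent K v ≡ r.
  _∈↑?_ : ∀ a v → Dec (a ∈↑ v)
  a ∈↑? v with reaches-root v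
  ... | K , upKv≡r =
    map′ (λ (k , _ , upkv≡a) → k , upkv≡a) within-K (anyUpTo? (λ k → up parent k v ≟ a) (suc K))
    where
    within-K : a ∈↑ v → ∃ λ k → k < suc K × up parent k v ≡ a
    within-K (k , upkv≡a) with k ≤? K
    ... | yes k≤K = k , s≤s k≤K , upkv≡a
    ... | no  k≰K = K , ≤-refl , trans upKv≡r (trans (sym (up-past-root upKv≡r (≰⇒≥ k≰K))) upkv≡a)

  subsetOf : {P : Fin n → Set} → Decidable P → Subset n
  subsetOf P? = tabulate (does ∘ P?)

  subsetOf-≐ : {P : Fin n → Set} (P? : Decidable P) → subsetOf P? ≐ P
  subsetOf-≐ P? x =
      (λ x∈ → does-true (P? x) (trans (sym lookup-x) ([]=⇒lookup x∈)))
    , (λ Px → lookup⇒[]= x (subsetOf P?) (trans lookup-x (dec-true (P? x) Px)))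
    where
    lookup-x : lookup (subsetOf P?) x ≡ does (P? x)
    lookup-x = lookup∘tabulate (does ∘ P?) x
    does-true : ∀ {A : Set} (A? : Dec A) → does A? ≡ true → A
    does-true (yes a) _  = a
    does-true (no _)  ()

  ≐-unique : ∀ {S S′ P} → S ≐ P → S′ ≐ P → S ≡ S′
  ≐-unique S≐P S′≐P = ⊆-antisym (λ {x} x∈S → proj₂ (S′≐P x) (proj₁ (S≐P x) x∈S))
                                (λ {x} x∈S′ → proj₂ (S≐P x) (proj₁ (S′≐P x) x∈S′))

  mincut-∩ : ∀ {S A} → IsMincut S → IsMincut A → Nonempty (S ∩ A) → IsMincut (S ∩ A)
  mincut-∩ {S} {A} ((r∉S , S≢∅) , S-min) ((r∉A , _) , A-min) (z , z∈S∩A) =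
    (r∉S ∘ proj₁ ∘ x∈p∩q⁻ S A , z , z∈S∩A) , λ S′ S′-cut → ℚ.≤-trans w[S∩A]≤w[A] (A-min S′ S′-cut)
    where
    S∪A-cut : IsCut (S ∪ A)
    S∪A-cut = [ r∉S , r∉A ] ∘ x∈p∪q⁻ S A , proj₁ S≢∅ , x∈p∪q⁺ (inj₁ (proj₂ S≢∅))
    w[S∩A]≤w[A] : cutWeight edges (S ∩ A) ≤ℚ cutWeight edges A
    w[S∩A]≤w[A] = +-cancelʳ-≤ (cutWeight edges (S ∪ A)) (begin
      cutWeight edges (S ∩ A) +ℚ cutWeight edges (S ∪ A) ≤⟨ cutWeight-submodular edges nonneg S A ⟩
      cutWeight edges S +ℚ cutWeight edges A             ≤⟨ ℚ.+-monoˡ-≤ (cutWeight edges A) (S-min (S ∪ A) S∪A-cut) ⟩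
      cutWeight edges (S ∪ A) +ℚ cutWeight edges A       ≡⟨ ℚ.+-comm (cutWeight edges (S ∪ A)) (cutWeight edges A) ⟩
      cutWeight edges A +ℚ cutWeight edges (S ∪ A)       ∎)
      where open ℚ.≤-Reasoning

  -- S ∩ A is a mincut containing u₁ and u₂; it is strictly smaller than S unless S ⊆ A.
  minimalMincut-⊆ : ∀ {u₁ u₂ S A} → IsMinimalMincut u₁ u₂ S → IsMincut A → u₁ ∈ A → u₂ ∈ A → S ⊆ A
  minimalMincut-⊆ {S = S} {A} (S-mincut , u₁∈S , u₂∈S , S-least) A-mincut u₁∈A u₂∈A {z} z∈S =
    decidable-stable (z ∈? A) λ z∉A →
      <⇒≱ (p⊂q⇒∣p∣<∣q∣ (p∩q⊆p S A , z , z∈S , z∉A ∘ proj₂ ∘ x∈p∩q⁻ S A))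
          (S-least (S ∩ A) (mincut-∩ S-mincut A-mincut (_ , x∈p∩q⁺ (u₁∈S , u₁∈A)))
                   (x∈p∩q⁺ (u₁∈S , u₁∈A)) (x∈p∩q⁺ (u₂∈S , u₂∈A)))

  IsMincut? : ∀ {S₀} → IsMincut S₀ → Decidable IsMincut
  IsMincut? {S₀} ((r∉S₀ , S₀≢∅) , S₀-min) S =
    map′ (λ (S-cut , S≤S₀) → S-cut , λ S′ S′-cut → ℚ.≤-trans S≤S₀ (S₀-min S′ S′-cut))
         (λ (S-cut , S-min) → S-cut , S-min S₀ (r∉S₀ , S₀≢∅))
         ((¬? (r ∈? S) ×-dec nonempty? S) ×-dec (cutWeight edges S ℚ.≤? cutWeight edges S₀))

  DiffIsMincut? : ∀ {S₀} → IsMincut S₀ → ∀ h v → Dec (DiffIsMincut h v)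
  DiffIsMincut? S₀-mincut h v =
    map′ (λ D-mincut → D , D-mincut , D≐)
         (λ (S , S-mincut , S≐) → subst IsMincut (≐-unique S≐ D≐) S-mincut)
         (IsMincut? S₀-mincut D)
    where
    D : Subset n
    D = subsetOf (λ x → (h ∈↑? x) ×-dec ¬? (v ∈↑? x))
    D≐ : D ≐ (λ x → x ∈↓ h × ¬ (x ∈↓ v))
    D≐ = subsetOf-≐ (λ x → (h ∈↑? x) ×-dec ¬? (v ∈↑? x))

  DiffIsMincut⇒≢ : ∀ {h v} → DiffIsMincut h v → h ≢ v
  DiffIsMincut⇒≢ (S , ((_ , x , x∈S) , _) , S≐) refl with proj₁ (S≐ x) x∈S
  ... | v↑x , ¬v↑x = ¬v↑x v↑x

  -- r itself would lie in r↓ ∖ v↓.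
  ¬DiffIsMincut-root : ∀ {v} → ¬ DiffIsMincut r v
  ¬DiffIsMincut-root {v} (S , ((r∉S , x , x∈S) , _) , S≐) with proj₁ (S≐ x) x∈S
  ... | r↑x , ¬v↑x =
    r∉S (proj₂ (S≐ r) (∈↑-refl , λ v↑r → ¬v↑x (subst (_∈↑ x) (sym (∈↑-root v↑r)) r↑x)))

  highest-DiffIsMincut : ∀ {k₀ v} → DiffIsMincut (up parent k₀ v) v →
    ∃ λ k → DiffIsMincut (up parent k v) v × (∀ j → DiffIsMincut (up parent j v) v → j ≤ℕ k)
  highest-DiffIsMincut {k₀} {v} diff₀@(_ , S₀-mincut , _) with reaches-root v
  ... | K , upKv≡r =
    greatest-satisfying (λ j → DiffIsMincut? S₀-mincut (up parent j v) v) below-K {k₀} diff₀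
    where
    below-K : ∀ j → DiffIsMincut (up parent j v) v → j < K
    below-K j diff = ≰⇒> λ K≤j →
      ¬DiffIsMincut-root (subst (λ h → DiffIsMincut h v) (up-past-root upKv≡r K≤j) diff)

  H-above : ∀ {u v} → u ∈⇑ v → DiffIsMincut u v → ∃ λ h → HIs v h × h ∈↑ u
  H-above {u} {v} u⇑v@((k₀ , upk₀v≡u) , _) diffᵤ
    with highest-DiffIsMincut {k₀} (subst (λ h → DiffIsMincut h v) (sym upk₀v≡u) diffᵤ)
  ... | k , diff , highest =
    up parent k v , (((k , refl) , DiffIsMincut⇒≢ diff) , diff , below) , below u u⇑v diffᵤ
    where
    below : ∀ h′ → h′ ∈⇑ v → DiffIsMincut h′ v → up parent k v ∈↑ h′
    below _ ((j , refl) , _) diff′ = k ∸ j , sym (up-∸ parent v (highest j diff′))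

  InTop-singleton : ∀ {P : Fin n → Set} {l} → (∀ y → P y → y ∈↓ l) → P l →
    ∀ v → (InTop P v → v ≡ l) × (v ≡ l → InTop P v)
  InTop-singleton {P} {l} P⊆l↓ Pl v = top⇒≡l , λ { refl → Pl , l-top }
    where
    l-top : ∀ y → y ∈⇑ l → ¬ P y
    l-top y (y↑l , y≢l) Py = y≢l (∈↑-antisym y↑l (P⊆l↓ y Py))
    top⇒≡l : InTop P v → v ≡ l
    top⇒≡l (Pv , v-top) = decidable-stable (v ≟ l) λ v≢l → v-top l (P⊆l↓ v Pv , v≢l ∘ sym) Pl

  module _ {u₁ u₂ uₑ lₑ lcaₑ xₑ : Fin n} {S : Subset n}
           (S-minimal : IsMinimalMincut u₁ u₂ S) (lₑ⇓uₑ : lₑ ∈⇓ uₑ)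
           (S≐ : S ≐ (λ x → x ∈↓ uₑ × ¬ (x ∈↓ lₑ)))
           (lcaₑ-lca : IsLCA u₁ u₂ lcaₑ) (xₑ-lca : IsLCA lₑ lcaₑ xₑ) where

    private
      Yₑ : Fin n → Set
      Yₑ y = OnPath u₁ u₂ y ⊎ OnPath xₑ lcaₑ y

      lcaₑ↑u₁ : lcaₑ ∈↑ u₁
      lcaₑ↑u₁ = proj₁ lcaₑ-lca

      lcaₑ↑u₂ : lcaₑ ∈↑ u₂
      lcaₑ↑u₂ = proj₁ (proj₂ lcaₑ-lca)

      xₑ↑lcaₑ : xₑ ∈↑ lcaₑ
      xₑ↑lcaₑ = proj₁ (proj₂ xₑ-lca)

      u₁∈uₑ↓∖lₑ↓ : u₁ ∈↓ uₑ × ¬ u₁ ∈↓ lₑ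
      u₁∈uₑ↓∖lₑ↓ = proj₁ (S≐ u₁) (proj₁ (proj₂ S-minimal))

      u₂∈uₑ↓∖lₑ↓ : u₂ ∈↓ uₑ × ¬ u₂ ∈↓ lₑ
      u₂∈uₑ↓∖lₑ↓ = proj₁ (S≐ u₂) (proj₁ (proj₂ (proj₂ S-minimal)))

      uₑ↑xₑ : uₑ ∈↑ xₑ
      uₑ↑xₑ = proj₂ (proj₂ xₑ-lca) uₑ (proj₁ lₑ⇓uₑ)
                (proj₂ (proj₂ lcaₑ-lca) uₑ (proj₁ u₁∈uₑ↓∖lₑ↓) (proj₁ u₂∈uₑ↓∖lₑ↓))

    ancestor-of-uᵢ∈Yₑ : ∀ {y} → xₑ ∈↑ y → y ∈↑ u₁ ⊎ y ∈↑ u₂ → Yₑ y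
    ancestor-of-uᵢ∈Yₑ {y} xₑ↑y y↑uᵢ with [ ∈↑-total lcaₑ↑u₁ , ∈↑-total lcaₑ↑u₂ ]′ y↑uᵢ
    ... | inj₁ lcaₑ↑y =
      inj₁ (y↑uᵢ , λ d d↑u₁ d↑u₂ → ∈↑-trans (proj₂ (proj₂ lcaₑ-lca) d d↑u₁ d↑u₂) lcaₑ↑y)
    ... | inj₂ y↑lcaₑ = inj₂ (inj₂ y↑lcaₑ , λ d d↑xₑ _ → ∈↑-trans d↑xₑ xₑ↑y)

    Lₓ∖Yₑ⊆lₑ↓ : ∀ y → InL xₑ y × ¬ Yₑ y → y ∈↓ lₑ
    Lₓ∖Yₑ⊆lₑ↓ y (((xₑ↑y , _) , h , (_ , (A , A-mincut , A≐) , _) , h↑xₑ) , y∉Yₑ) =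
      decidable-stable (lₑ ∈↑? y) λ ¬lₑ↑y →
        y∉A (minimalMincut-⊆ S-minimal A-mincut (uᵢ∈A lcaₑ↑u₁ inj₁) (uᵢ∈A lcaₑ↑u₂ inj₂)
               (proj₂ (S≐ y) (∈↑-trans uₑ↑xₑ xₑ↑y , ¬lₑ↑y)))
      where
      y∉A : y ∉ A
      y∉A y∈A = proj₂ (proj₁ (A≐ y) y∈A) ∈↑-refl
      uᵢ∈A : ∀ {u} → lcaₑ ∈↑ u → (∀ {z} → z ∈↑ u → z ∈↑ u₁ ⊎ z ∈↑ u₂) → u ∈ A
      uᵢ∈A {u} lcaₑ↑u endpoint =
        proj₂ (A≐ u) (∈↑-trans h↑xₑ (∈↑-trans xₑ↑lcaₑ lcaₑ↑u) , y∉Yₑ ∘ ancestor-of-uᵢ∈Yₑ xₑ↑y ∘ endpoint)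

    lₑ∈Lₓ∖Yₑ : InL xₑ lₑ × ¬ Yₑ lₑ
    lₑ∈Lₓ∖Yₑ with H-above lₑ⇓uₑ (S , proj₁ S-minimal , S≐)
    ... | H , H-is-H , H↑uₑ = ((proj₁ xₑ-lca , xₑ≢lₑ) , H , H-is-H , ∈↑-trans H↑uₑ uₑ↑xₑ) , lₑ∉Yₑ
      where
      xₑ≢lₑ : xₑ ≢ lₑ
      xₑ≢lₑ refl = proj₂ u₁∈uₑ↓∖lₑ↓ (∈↑-trans xₑ↑lcaₑ lcaₑ↑u₁)
      lₑ∉Yₑ : ¬ Yₑ lₑ
      lₑ∉Yₑ (inj₁ (inj₁ lₑ↑u₁ , _))   = proj₂ u₁∈uₑ↓∖lₑ↓ lₑ↑u₁
      lₑ∉Yₑ (inj₁ (inj₂ lₑ↑u₂ , _))   = proj₂ u₂∈uₑ↓∖lₑ↓ lₑ↑u₂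
      lₑ∉Yₑ (inj₂ (inj₁ lₑ↑xₑ , _))   = proj₂ u₁∈uₑ↓∖lₑ↓ (∈↑-trans lₑ↑xₑ (∈↑-trans xₑ↑lcaₑ lcaₑ↑u₁))
      lₑ∉Yₑ (inj₂ (inj₂ lₑ↑lcaₑ , _)) = proj₂ u₁∈uₑ↓∖lₑ↓ (∈↑-trans lₑ↑lcaₑ lcaₑ↑u₁)

lemma5p9 : (𝒮 : Setting) → let open Setting 𝒮 in
    (u₁ u₂ uₑ lₑ lcaₑ xₑ : Fin n) → (S : Subset n) →
    IsEdge u₁ u₂ → IsRightEdge u₁ u₂ →
    IsMinimalMincut u₁ u₂ S → lₑ ∈⇓ uₑ →
    S ≐ (λ x → x ∈↓ uₑ × ¬ (x ∈↓ lₑ)) →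
    IsLCA u₁ u₂ lcaₑ → IsLCA lₑ lcaₑ xₑ →
    ∀ v → (InTop (λ y → InL xₑ y × ¬ (OnPath u₁ u₂ y ⊎ OnPath xₑ lcaₑ y)) v → v ≡ lₑ)
    × (v ≡ lₑ → InTop (λ y → InL xₑ y × ¬ (OnPath u₁ u₂ y ⊎ OnPath xₑ lcaₑ y)) v)
lemma5p9 𝒮 u₁ u₂ uₑ lₑ lcaₑ xₑ S _ _ S-minimal lₑ⇓uₑ S≐ lcaₑ-lca xₑ-lca =
  InTop-singleton 𝒮 (Lₓ∖Yₑ⊆lₑ↓ 𝒮 S-minimal lₑ⇓uₑ S≐ lcaₑ-lca xₑ-lca)
                    (lₑ∈Lₓ∖Yₑ 𝒮 S-minimal lₑ⇓uₑ S≐ lcaₑ-lca xₑ-lca)
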